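{- Let $L$ be a finite join-semidistributive lattice. Then the canonical join complex of $L$ is flag if and only if $L$ is semidistributive.
   Context: All lattices are finite. A join $\bigvee A$ (for $A\subseteq L$) is irredundant if $\bigvee A'<\bigvee A$ for every proper subset $A'\subsetneq A$. For subsets $A,B\subseteq L$, $A$ join-refines $B$ if for every $a\in A$ there is $b\in B$ with $a\le b$. The canonical join representation of $w\in L$, when it exists, is the unique minimal element, with respect to join-refinement, of the set of irredundant join-representations $A$ of $w$ (i.e. $\bigvee A=w$); a set $A$ "joins canonically" if $A$ is the canonical join representation of $\bigvee A$. The canonical meet representation is defined dually. $L$ is join-semidistributive if $x\vee y=x\vee z$ implies $x\vee(y\wedge z)=x\vee y$ for all $x,y,z\in L$; meet-semidistributive is the dual condition ($x\wedge y=x\wedge z$ implies $x\wedge(y\vee z)=x\wedge y$); semidistributive means both. For finite $L$, join-semidistributivity is equivalent to every element having a canonical join representation (dually for meet). When $L$ is join-semidistributive, its canonical join complex is the simplicial complex whose faces are the subsets $A\subseteq L$ that join canonically. A simplicial complex is flag if its minimal non-faces all have size two. -}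

module Defs where

open import Data.Nat using (ℕ; suc)
open import Data.Fin using (Fin)
open import Data.Fin.Subset using (Subset; _∈_; _⊂_; ∣_∣; ⁅_⁆)
open import Data.Vec using (lookup)
open import Data.List using (foldr; allFin)
open import Data.Bool using (if_then_else_)
open import Data.Product using (Σ; _×_; ∃)
open import Relation.Binary.PropositionalEquality using (_≡_; _≢_)
open import Relation.Nullary using (¬_)
open import Algebra.Core using (Op₂)
open import Algebra.Lattice.Structures using (IsLattice)

-- A finite (nonempty) lattice, presented (up to isomorphism) on the
-- carrier Fin (suc m), with propositional equality as the equality.
record FiniteLattice : Set where
  field
    m         : ℕ
    _∨_       : Op₂ (Fin (suc m))
    _∧_       : Op₂ (Fin (suc m))
    isLattice : IsLattice _≡_ _∨_ _∧_

module _ (L : FiniteLattice) where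
  open FiniteLattice L

  Elt : Set
  Elt = Fin (suc m)

  _≤_ : Elt → Elt → Set
  x ≤ y = x ∨ y ≡ y

  _<_ : Elt → Elt → Set
  x < y = x ≤ y × x ≢ y

  bot : Elt
  bot = foldr _∧_ (Data.Fin.zero) (allFin (suc m))

  ⋁ : Subset (suc m) → Elt
  ⋁ A = foldr (λ i acc → if lookup A i then i ∨ acc else acc) bot (allFin (suc m))

  Irredundant : Subset (suc m) → Set
  Irredundant A = ∀ A′ → A′ ⊂ A → ⋁ A′ < ⋁ A

  JoinRefines : Subset (suc m) → Subset (suc m) → Set
  JoinRefines A B = ∀ a → a ∈ A → ∃ λ b → b ∈ B × a ≤ b

  IrrJoinRep : Elt → Subset (suc m) → Set
  IrrJoinRep w A = Irredundant A × ⋁ A ≡ w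

  MinimalIrrJoinRep : Elt → Subset (suc m) → Set
  MinimalIrrJoinRep w A =
    IrrJoinRep w A × (∀ B → IrrJoinRep w B → JoinRefines B A → B ≡ A)

  CanonicalJoinRep : Elt → Subset (suc m) → Set
  CanonicalJoinRep w A =
    MinimalIrrJoinRep w A × (∀ C → MinimalIrrJoinRep w C → C ≡ A)

  JoinsCanonically : Subset (suc m) → Set
  JoinsCanonically A = CanonicalJoinRep (⋁ A) A

  JoinSemidistributive : Set
  JoinSemidistributive =
    ∀ x y z → x ∨ y ≡ x ∨ z → x ∨ (y ∧ z) ≡ x ∨ y

  MeetSemidistributive : Set
  MeetSemidistributive =
    ∀ x y z → x ∧ y ≡ x ∧ z → x ∧ (y ∨ z) ≡ x ∧ y

  Semidistributive : Set
  Semidistributive = JoinSemidistributive × MeetSemidistributive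

  Face : Subset (suc m) → Set
  Face = JoinsCanonically

  Vertex : Elt → Set
  Vertex v = Face ⁅ v ⁆

  MinimalNonFace : Subset (suc m) → Set
  MinimalNonFace A =
    (∀ v → v ∈ A → Vertex v) × ¬ Face A × (∀ B → B ⊂ A → Face B)

  CanonicalJoinComplexIsFlag : Set
  CanonicalJoinComplexIsFlag = ∀ A → MinimalNonFace A → ∣ A ∣ ≡ 2

module Submission where

-- In a join-semidistributive lattice a set A joins canonically exactly when it is tight:
-- no a ∈ A lies below the join of A ∖ {a} together with the elements strictly below a.
-- Indeed the canonical join representation of w consists of, for each lower cover y of w,
-- the least γ with y ∨ γ = w, and a tight set is the canonical representation of its join.
--
-- If L is also meet-semidistributive, tightness of A ∖ {p} and A ∖ {q} forces tightness of
-- A at every other element, so a minimal non-face has exactly two elements. Conversely, if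
-- x ∧ y = x ∧ z but x ∧ (y ∨ z) ≰ x ∧ y, let j be minimal below x ∧ (y ∨ z) and not below
-- x ∧ y. Then j together with the canonical joinands of y ∨ z not strictly below j is a
-- non-face all of whose subsets with at most two elements are faces, so some minimal
-- non-face has at least three elements.

open import Algebra.Lattice.Bundles using (Lattice)
open import Algebra.Lattice.Structures using (IsLattice)
import Algebra.Lattice.Properties.Lattice as LatticeProperties
open import Data.Bool using (true; false; if_then_else_)
open import Data.Fin using (Fin; _≟_)
open import Data.Fin.Induction using (po-wellFounded; po-noetherian)
open import Data.Fin.Properties using (any?; all?)
open import Data.Fin.Subset
  using (Subset; inside; outside; _∈_; _∉_; _⊆_; _⊂_; _∪_; _─_; _-_; ∣_∣; ⁅_⁆; Empty)
open import Data.Fin.Subset.Induction using (⊂-wellFounded)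
open import Data.Fin.Subset.Properties
  using ( _∈?_; nonempty?; _⊆?_; _⊂?_; anySubset?; ⊆-refl; ⊆-trans; ⊆-antisym; p⊂q⇒p⊆q
        ; x∈⁅x⁆; x∈⁅y⁆⇒x≡y; x∈p∪q⁺; x∈p∪q⁻; p─q⊆p; x∈p∧x∉q⇒x∈p─q; x∈p∧x≢y⇒x∈p-y
        ; p─x─y≡p─y─x; x∈p⇒p-x⊂p; p─⊥≡p; Empty-unique; ∣⊥∣≡0 )
open import Data.List using ([]; _∷_; foldr; allFin)
import Data.List.Membership.Propositional as List
open import Data.List.Membership.Propositional.Properties using (∈-allFin)
open import Data.List.Relation.Unary.Any using (here; there)
open import Data.Nat as ℕ using (ℕ; suc; s≤s; z≤n)
open import Data.Nat.Properties using (<-irrefl)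
open import Data.Product using (∃; ∃-syntax; _×_; _,_; proj₁; proj₂)
open import Data.Sum using (_⊎_; inj₁; inj₂; [_,_]′)
open import Data.Vec using (_∷_; lookup; tabulate; here; there)
open import Data.Vec.Properties using ([]=⇒lookup; lookup⇒[]=; lookup∘tabulate)
open import Defs hiding (_≤_; _<_; ⋁)
import Defs
open import Function using (_∘_)
open import Function.Bundles using (_⇔_; mk⇔)
open import Induction.WellFounded using (WellFounded; Acc; acc)
open import Level using (Level; 0ℓ)
open import Relation.Binary using (Rel; IsPartialOrder)
open import Relation.Binary.PropositionalEquality
  using (_≡_; _≢_; refl; sym; trans; cong; subst; isEquivalence; module ≡-Reasoning)
open import Relation.Nullary using (¬_; Dec; yes; no; does; contradiction)
open import Relation.Nullary.Decidable using (_×-dec_; _→-dec_; ¬?; decidable-stable; map′; dec-true)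
open import Relation.Unary using (Pred; Decidable)

private
  variable
    a ℓ r : Level
    n : ℕ

module _ {A : Set a} {_≺_ : Rel A r} (≺-wf : WellFounded _≺_) {P : Pred A ℓ}
         (∃≺? : ∀ x → Dec (∃[ y ] y ≺ x × P y)) where

  wf-minimal : ∀ {x} → P x → ∃[ y ] P y × (∀ {z} → z ≺ y → ¬ P z)
  wf-minimal {x} = go (≺-wf x)
    where
    go : ∀ {x} → Acc _≺_ x → P x → ∃[ y ] P y × (∀ {z} → z ≺ y → ¬ P z)
    go {x} (acc rs) Px with ∃≺? x
    ... | yes (y , y≺x , Py) = go (rs y≺x) Py
    ... | no ∄y = x , Px , λ z≺x Pz → ∄y (_ , z≺x , Pz)

-- Finite subsets

-- toSubset, Rest and Joinands are opaque so that the type checker never unfolds a join ⋁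
-- over them while solving unification problems.
opaque
  toSubset : {P : Pred (Fin n) ℓ} → Decidable P → Subset n
  toSubset P? = tabulate (does ∘ P?)

  ∈-toSubset⁺ : {P : Pred (Fin n) ℓ} (P? : Decidable P) → ∀ {x} → P x → x ∈ toSubset P?
  ∈-toSubset⁺ P? {x} Px = lookup⇒[]= x _ (trans (lookup∘tabulate _ x) (dec-true (P? x) Px))

  ∈-toSubset⁻ : {P : Pred (Fin n) ℓ} (P? : Decidable P) → ∀ {x} → x ∈ toSubset P? → P x
  ∈-toSubset⁻ P? {x} x∈ with P? x | trans (sym (lookup∘tabulate (does ∘ P?) x)) ([]=⇒lookup x∈)
  ... | yes Px | _ = Px
  ... | no _   | ()

x∈p─q⇒x∉q : ∀ (p q : Subset n) {x} → x ∈ p ─ q → x ∉ q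
x∈p─q⇒x∉q (_ ∷ p) (outside ∷ q) (there x∈) (there x∈q) = x∈p─q⇒x∉q p q x∈ x∈q
x∈p─q⇒x∉q (_ ∷ p) (inside ∷ q)  (there x∈) (there x∈q) = x∈p─q⇒x∉q p q x∈ x∈q
x∈p─q⇒x∉q (inside ∷ p) (outside ∷ q) here ()

x∈p-y⇒x≢y : ∀ {p : Subset n} {x y} → x ∈ p - y → x ≢ y
x∈p-y⇒x≢y {p = p} {x} x∈ refl = x∈p─q⇒x∉q p ⁅ x ⁆ x∈ (x∈⁅x⁆ x)

x∈p-y⇒x∈p : ∀ {p : Subset n} {x y} → x ∈ p - y → x ∈ p
x∈p-y⇒x∈p {p = p} {y = y} = p─q⊆p p ⁅ y ⁆

∣p∣≡1+∣p-x∣ : ∀ {p : Subset n} {x} → x ∈ p → ∣ p ∣ ≡ ℕ.suc ∣ p - x ∣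
∣p∣≡1+∣p-x∣ {p = inside ∷ p}  here        = cong ℕ.suc (cong ∣_∣ (sym (p─⊥≡p p)))
∣p∣≡1+∣p-x∣ {p = inside ∷ p}  (there x∈p) = cong ℕ.suc (∣p∣≡1+∣p-x∣ x∈p)
∣p∣≡1+∣p-x∣ {p = outside ∷ p} (there x∈p) = ∣p∣≡1+∣p-x∣ x∈p

Empty⇒∣p∣≡0 : {p : Subset n} → Empty p → ∣ p ∣ ≡ 0
Empty⇒∣p∣≡0 {n} e = trans (cong ∣_∣ (Empty-unique e)) (∣⊥∣≡0 n)

Subsingleton : Subset n → Set
Subsingleton p = ∀ {x y} → x ∈ p → y ∈ p → x ≡ y

record ThreeDistinct (p : Subset n) : Set where
  constructor threeDistinct
  field
    {x y z} : Fin n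
    x∈p : x ∈ p
    y∈p : y ∈ p
    z∈p : z ∈ p
    x≢y : x ≢ y
    x≢z : x ≢ z
    y≢z : y ≢ z

3≤∣p∣ : {p : Subset n} → ThreeDistinct p → 3 ℕ.≤ ∣ p ∣
3≤∣p∣ {p = p} (threeDistinct {x} {y} {z} x∈p y∈p z∈p x≢y x≢z y≢z)
  rewrite ∣p∣≡1+∣p-x∣ x∈p
        | ∣p∣≡1+∣p-x∣ (x∈p∧x≢y⇒x∈p-y y∈p (x≢y ∘ sym))
        | ∣p∣≡1+∣p-x∣ (x∈p∧x≢y⇒x∈p-y (x∈p∧x≢y⇒x∈p-y z∈p (x≢z ∘ sym)) (y≢z ∘ sym))
  = s≤s (s≤s (s≤s z≤n))

data SizeView (p : Subset n) : Set where
  subsingleton  : Subsingleton p → SizeView p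
  two           : ∣ p ∣ ≡ 2 → SizeView p
  atLeastThree  : ThreeDistinct p → SizeView p

sizeView : (p : Subset n) → SizeView p
sizeView p with nonempty? p
... | no ∄x = subsingleton λ x∈p _ → contradiction (_ , x∈p) ∄x
... | yes (x , x∈p) with nonempty? (p - x)
...   | no ∄y = subsingleton λ a∈p b∈p → trans (only-x a∈p) (sym (only-x b∈p))
  where
  only-x : ∀ {a} → a ∈ p → a ≡ x
  only-x {a} a∈p with a ≟ x
  ... | yes a≡x = a≡x
  ... | no a≢x  = contradiction (a , x∈p∧x≢y⇒x∈p-y a∈p a≢x) ∄y
...   | yes (y , y∈p-x) with nonempty? (p - x - y)
...     | no ∄z = two (begin
            ∣ p ∣                   ≡⟨ ∣p∣≡1+∣p-x∣ x∈p ⟩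
            ℕ.suc ∣ p - x ∣         ≡⟨ cong ℕ.suc (∣p∣≡1+∣p-x∣ y∈p-x) ⟩
            2 ℕ.+ ∣ p - x - y ∣     ≡⟨ cong (2 ℕ.+_) (Empty⇒∣p∣≡0 ∄z) ⟩
            2                       ∎)
  where open ≡-Reasoning
...     | yes (z , z∈p-x-y) = atLeastThree (threeDistinct
            x∈p (x∈p-y⇒x∈p y∈p-x) (x∈p-y⇒x∈p z∈p-x)
            (x∈p-y⇒x≢y y∈p-x ∘ sym) (x∈p-y⇒x≢y z∈p-x ∘ sym) (x∈p-y⇒x≢y z∈p-x-y ∘ sym))
  where
  z∈p-x : z ∈ p - x
  z∈p-x = x∈p-y⇒x∈p z∈p-x-y

two-others : {p : Subset n} → ThreeDistinct p → ∀ w →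
            ∃[ u ] ∃[ v ] u ∈ p × v ∈ p × u ≢ w × v ≢ w × u ≢ v
two-others (threeDistinct {x} {y} {z} x∈p y∈p z∈p x≢y x≢z y≢z) w with w ≟ x | w ≟ y
... | yes refl | _        = y , z , y∈p , z∈p , x≢y ∘ sym , x≢z ∘ sym , y≢z
... | no _     | yes refl = x , z , x∈p , z∈p , x≢y , y≢z ∘ sym , x≢z
... | no w≢x   | no w≢y   = x , y , x∈p , y∈p , w≢x ∘ sym , w≢y ∘ sym , x≢y

Subsingleton⇒¬ThreeDistinct : {p : Subset n} → Subsingleton p → ¬ ThreeDistinct p
Subsingleton⇒¬ThreeDistinct p-sub (threeDistinct x∈p y∈p _ x≢y _ _) = x≢y (p-sub x∈p y∈p)

¬ThreeDistinct⇒Subsingleton-minus : {p : Subset n} → ¬ ThreeDistinct p → ∀ {x} → x ∈ p →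
                                    Subsingleton (p - x)
¬ThreeDistinct⇒Subsingleton-minus ¬three x∈p {y} {z} y∈ z∈ with y ≟ z
... | yes y≡z = y≡z
... | no y≢z  = contradiction (threeDistinct (x∈p-y⇒x∈p y∈) (x∈p-y⇒x∈p z∈) x∈p
                                             y≢z (x∈p-y⇒x≢y y∈) (x∈p-y⇒x≢y z∈)) ¬three

⊂-minimal : {P : Pred (Subset n) ℓ} → Decidable P → ∀ {p} → P p →
            ∃[ q ] P q × (∀ {r} → r ⊂ q → ¬ P r)
⊂-minimal P? = wf-minimal ⊂-wellFounded (λ p → anySubset? λ q → (q ⊂? p) ×-dec P? q)

-- The lattice order, joins of subsets and lower covers

module _ (L : FiniteLattice) where

  open FiniteLattice L
  open IsLattice isLattice using (∨-comm; ∨-assoc; ∧-comm; ∧-assoc; ∨-absorbs-∧; ∧-absorbs-∨)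

  lattice : Lattice 0ℓ 0ℓ
  lattice = record { isLattice = isLattice }

  open LatticeProperties lattice using (∨-idem)

  infix 4 _≤_ _<_ _≤?_ _<?_

  _≤_ : Elt L → Elt L → Set
  _≤_ = Defs._≤_ L

  _<_ : Elt L → Elt L → Set
  _<_ = Defs._<_ L

  ⋁ : Subset (suc m) → Elt L
  ⋁ = Defs.⋁ L

  _≤?_ : (x y : Elt L) → Dec (x ≤ y)
  x ≤? y = (x ∨ y) ≟ y

  _<?_ : (x y : Elt L) → Dec (x < y)
  x <? y = (x ≤? y) ×-dec ¬? (x ≟ y)

  ≤-refl : ∀ {x} → x ≤ x
  ≤-refl {x} = ∨-idem x

  ≤-trans : ∀ {x y z} → x ≤ y → y ≤ z → x ≤ z
  ≤-trans {x} {y} {z} x≤y y≤z = begin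
    x ∨ z         ≡⟨ cong (x ∨_) (sym y≤z) ⟩
    x ∨ (y ∨ z)   ≡⟨ sym (∨-assoc x y z) ⟩
    (x ∨ y) ∨ z   ≡⟨ cong (_∨ z) x≤y ⟩
    y ∨ z         ≡⟨ y≤z ⟩
    z             ∎
    where open ≡-Reasoning

  ≤-antisym : ∀ {x y} → x ≤ y → y ≤ x → x ≡ y
  ≤-antisym {x} {y} x≤y y≤x = trans (sym y≤x) (trans (∨-comm y x) x≤y)

  ≤-isPartialOrder : IsPartialOrder _≡_ _≤_
  ≤-isPartialOrder = record
    { isPreorder = record
      { isEquivalence = isEquivalence
      ; reflexive     = λ { refl → ≤-refl }
      ; trans         = ≤-trans
      }
    ; antisym = ≤-antisym
    }

  x≤x∨y : ∀ x y → x ≤ x ∨ y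
  x≤x∨y x y = trans (sym (∨-assoc x x y)) (cong (_∨ y) (∨-idem x))

  y≤x∨y : ∀ x y → y ≤ x ∨ y
  y≤x∨y x y = subst (y ≤_) (∨-comm y x) (x≤x∨y y x)

  ∨-least : ∀ {x y z} → x ≤ z → y ≤ z → x ∨ y ≤ z
  ∨-least {x} {y} {z} x≤z y≤z = trans (∨-assoc x y z) (trans (cong (x ∨_) y≤z) x≤z)

  ≤⇒∨≡ : ∀ {x y} → x ≤ y → y ∨ x ≡ y
  ≤⇒∨≡ {x} {y} x≤y = trans (∨-comm y x) x≤y

  ≤⇒∧≡ : ∀ {x y} → x ≤ y → x ∧ y ≡ x
  ≤⇒∧≡ {x} {y} x≤y = trans (cong (x ∧_) (sym x≤y)) (∧-absorbs-∨ x y)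

  ∧≡⇒≤ : ∀ {x y} → x ∧ y ≡ x → x ≤ y
  ∧≡⇒≤ {x} {y} x∧y≡x = begin
    x ∨ y         ≡⟨ cong (_∨ y) (sym x∧y≡x) ⟩
    (x ∧ y) ∨ y   ≡⟨ ∨-comm (x ∧ y) y ⟩
    y ∨ (x ∧ y)   ≡⟨ cong (y ∨_) (∧-comm x y) ⟩
    y ∨ (y ∧ x)   ≡⟨ ∨-absorbs-∧ y x ⟩
    y             ∎
    where open ≡-Reasoning

  x∧y≤x : ∀ x y → x ∧ y ≤ x
  x∧y≤x x y = ∧≡⇒≤ (begin
    (x ∧ y) ∧ x   ≡⟨ ∧-comm (x ∧ y) x ⟩
    x ∧ (x ∧ y)   ≡⟨ sym (∧-assoc x x y) ⟩
    (x ∧ x) ∧ y   ≡⟨ cong (_∧ y) (≤⇒∧≡ (≤-refl {x})) ⟩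
    x ∧ y         ∎)
    where open ≡-Reasoning

  x∧y≤y : ∀ x y → x ∧ y ≤ y
  x∧y≤y x y = subst (_≤ y) (∧-comm y x) (x∧y≤x y x)

  ∧-greatest : ∀ {x y z} → x ≤ y → x ≤ z → x ≤ y ∧ z
  ∧-greatest {x} {y} {z} x≤y x≤z =
    ∧≡⇒≤ (trans (sym (∧-assoc x y z)) (trans (cong (_∧ z) (≤⇒∧≡ x≤y)) (≤⇒∧≡ x≤z)))

  <-≤-trans : ∀ {x y z} → x < y → y ≤ z → x ≤ z
  <-≤-trans (x≤y , _) = ≤-trans x≤y

  private
    step : Subset (suc m) → Elt L → Elt L → Elt L
    step A x b = if lookup A x then x ∨ b else b

    foldr-∧-≤ : ∀ {z x} xs → x List.∈ xs → foldr _∧_ z xs ≤ x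
    foldr-∧-≤ (y ∷ xs) (here refl)  = x∧y≤x y _
    foldr-∧-≤ (y ∷ xs) (there x∈xs) = ≤-trans (x∧y≤y y _) (foldr-∧-≤ xs x∈xs)

  bot≤ : ∀ x → bot L ≤ x
  bot≤ x = foldr-∧-≤ (allFin _) (∈-allFin x)

  private
    foldr-step-upper : ∀ {A x} xs → x List.∈ xs → x ∈ A → x ≤ foldr (step A) (bot L) xs
    foldr-step-upper (y ∷ xs) (here refl) x∈A rewrite []=⇒lookup x∈A = x≤x∨y y _
    foldr-step-upper {A} (y ∷ xs) (there x∈xs) x∈A with lookup A y
    ... | true  = ≤-trans (foldr-step-upper xs x∈xs x∈A) (y≤x∨y y _)
    ... | false = foldr-step-upper xs x∈xs x∈A

    foldr-step-least : ∀ {A u} xs → (∀ {x} → x ∈ A → x ≤ u) → foldr (step A) (bot L) xs ≤ u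
    foldr-step-least []                 _   = bot≤ _
    foldr-step-least {A} (y ∷ xs) A≤u with lookup A y in eq
    ... | true  = ∨-least (A≤u (lookup⇒[]= y A eq)) (foldr-step-least xs A≤u)
    ... | false = foldr-step-least xs A≤u

  ⋁-upper : ∀ {A x} → x ∈ A → x ≤ ⋁ A
  ⋁-upper {x = x} = foldr-step-upper (allFin _) (∈-allFin x)

  ⋁-least : ∀ {A u} → (∀ {x} → x ∈ A → x ≤ u) → ⋁ A ≤ u
  ⋁-least = foldr-step-least (allFin _)

  ⋁-mono : ∀ {A B} → A ⊆ B → ⋁ A ≤ ⋁ B
  ⋁-mono A⊆B = ⋁-least (⋁-upper ∘ A⊆B)

  ⋁≰⇒∃≰ : ∀ {A u} → ¬ ⋁ A ≤ u → ∃[ x ] x ∈ A × ¬ x ≤ u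
  ⋁≰⇒∃≰ {A} {u} ⋁A≰u with any? (λ x → (x ∈? A) ×-dec ¬? (x ≤? u))
  ... | yes found = found
  ... | no ∄x = contradiction
    (⋁-least λ {x} x∈A → decidable-stable (x ≤? u) (λ x≰u → ∄x (x , x∈A , x≰u))) ⋁A≰u

  Minimal : Pred (Elt L) 0ℓ → Elt L → Set
  Minimal Q x = Q x × (∀ {y} → y < x → ¬ Q y)

  minimal : ∀ {Q : Pred (Elt L) 0ℓ} → Decidable Q → ∀ {x} → Q x → ∃ (Minimal Q)
  minimal Q? = wf-minimal (po-wellFounded ≤-isPartialOrder) (λ x → any? (λ y → (y <? x) ×-dec Q? y))

  Minimal? : ∀ {Q : Pred (Elt L) 0ℓ} → Decidable Q → Decidable (Minimal Q)
  Minimal? Q? x = Q? x ×-dec map′ (λ h {y} → h y) (λ h y → h {y}) (all? λ y → (y <? x) →-dec ¬? (Q? y))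

  maximal : ∀ {Q : Pred (Elt L) 0ℓ} → Decidable Q → ∀ {x} → Q x → ∃[ y ] Q y × (∀ {z} → y < z → ¬ Q z)
  maximal Q? = wf-minimal (po-noetherian ≤-isPartialOrder) (λ x → any? (λ y → (x <? y) ×-dec Q? y))

  infix 4 _⋖_ _⋖?_

  _⋖_ : Elt L → Elt L → Set
  y ⋖ w = y < w × (∀ t → y < t → t ≤ w → t ≡ w)

  _⋖?_ : (y w : Elt L) → Dec (y ⋖ w)
  y ⋖? w = (y <? w) ×-dec all? (λ t → (y <? t) →-dec ((t ≤? w) →-dec (t ≟ w)))

  ∃-⋖ : ∀ {u w} → u < w → ∃[ y ] u ≤ y × y ⋖ w
  ∃-⋖ {u} {w} u<w with maximal (λ y → (u ≤? y) ×-dec (y <? w)) (≤-refl , u<w)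
  ... | y , (u≤y , y<w) , y-max = y , u≤y , y<w , λ t y<t t≤w →
    decidable-stable (t ≟ w) λ t≢w → y-max y<t (≤-trans u≤y (proj₁ y<t) , t≤w , t≢w)

  ⋖⇒≱ : ∀ {y w} → y ⋖ w → ¬ w ≤ y
  ⋖⇒≱ ((y≤w , y≢w) , _) w≤y = y≢w (≤-antisym y≤w w≤y)

  ⋖-∨ : ∀ {y w t} → y ⋖ w → t ≤ w → ¬ t ≤ y → y ∨ t ≡ w
  ⋖-∨ {y} {w} {t} ((y≤w , _) , y-cov) t≤w t≰y =
    y-cov (y ∨ t) (x≤x∨y y t , λ y≡y∨t → t≰y (subst (t ≤_) (sym y≡y∨t) (y≤x∨y y t)))
          (∨-least y≤w t≤w)

  ⋖-incomparable : ∀ {y y′ w} → y ⋖ w → y′ ⋖ w → y ≢ y′ → ¬ y ≤ y′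
  ⋖-incomparable (_ , y-cov) ((y′≤w , y′≢w) , _) y≢y′ y≤y′ = y′≢w (y-cov _ (y≤y′ , y≢y′) y′≤w)

  -- Tight sets

  Below : Elt L → Subset (suc m)
  Below a = toSubset (_<? a)

  opaque
    Rest : Subset (suc m) → Elt L → Subset (suc m)
    Rest A a = (A - a) ∪ Below a

    ∈-Rest⁺ : ∀ {A a x} → x ∈ A → x ≢ a → x ∈ Rest A a
    ∈-Rest⁺ x∈A x≢a = x∈p∪q⁺ (inj₁ (x∈p∧x≢y⇒x∈p-y x∈A x≢a))

    <⇒∈-Rest : ∀ A {a x} → x < a → x ∈ Rest A a
    <⇒∈-Rest _ x<a = x∈p∪q⁺ (inj₂ (∈-toSubset⁺ (_<? _) x<a))

    ∈-Rest⁻ : ∀ {A a x} → x ∈ Rest A a → (x ∈ A × x ≢ a) ⊎ x < a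
    ∈-Rest⁻ {A} {a} x∈ with x∈p∪q⁻ (A - a) (Below a) x∈
    ... | inj₁ x∈A-a = inj₁ (x∈p-y⇒x∈p x∈A-a , x∈p-y⇒x≢y x∈A-a)
    ... | inj₂ x∈↓a  = inj₂ (∈-toSubset⁻ (_<? a) x∈↓a)

    ⋁Rest≤ : ∀ {A a t} → (∀ {e} → e ∈ A - a → e ≤ t) → (∀ {e} → e < a → e ≤ t) → ⋁ (Rest A a) ≤ t
    ⋁Rest≤ {A} {a} others≤t below≤t = ⋁-least λ e∈ → [ others≤t , below≤t ∘ ∈-toSubset⁻ (_<? a) ]′
                                                     (x∈p∪q⁻ (A - a) (Below a) e∈)

  ≰⋁Rest : ∀ {A a t} → ¬ a ≤ t → (∀ {e} → e ∈ A - a → e ≤ t) → (∀ {e} → e < a → e ≤ t) →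
           ¬ a ≤ ⋁ (Rest A a)
  ≰⋁Rest a≰t others≤t below≤t a≤⋁ = a≰t (≤-trans a≤⋁ (⋁Rest≤ others≤t below≤t))

  Tight : Subset (suc m) → Set
  Tight A = ∀ a → a ∈ A → ¬ a ≤ ⋁ (Rest A a)

  Rest-mono : ∀ {A B} a → B ⊆ A → Rest B a ⊆ Rest A a
  Rest-mono _ B⊆A x∈ with ∈-Rest⁻ x∈
  ... | inj₁ (x∈B , x≢a) = ∈-Rest⁺ (B⊆A x∈B) x≢a
  ... | inj₂ x<a         = <⇒∈-Rest _ x<a

  ⋁Rest≤⋁ : ∀ {A a} → a ∈ A → ⋁ (Rest A a) ≤ ⋁ A
  ⋁Rest≤⋁ {A} {a} a∈A = ⋁-least λ x∈ → bound (∈-Rest⁻ x∈)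
    where
    bound : ∀ {x} → (x ∈ A × x ≢ a) ⊎ x < a → x ≤ ⋁ A
    bound (inj₁ (x∈A , _)) = ⋁-upper x∈A
    bound (inj₂ x<a)       = <-≤-trans x<a (⋁-upper a∈A)

  Tight? : (A : Subset (suc m)) → Dec (Tight A)
  Tight? A = all? λ a → (a ∈? A) →-dec ¬? (a ≤? ⋁ (Rest A a))

  Tight-antitone : ∀ {A B} → B ⊆ A → Tight A → Tight B
  Tight-antitone B⊆A A-tight a a∈B a≤⋁ =
    A-tight a (B⊆A a∈B) (≤-trans a≤⋁ (⋁-mono (Rest-mono a B⊆A)))

  Tight⇒Irredundant : ∀ {A} → Tight A → Irredundant L A
  Tight⇒Irredundant {A} A-tight A′ (A′⊆A , a , a∈A , a∉A′) = ⋁-mono A′⊆A , λ ⋁A′≡⋁A →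
    A-tight a a∈A (≤-trans (⋁-upper a∈A) (subst (_≤ ⋁ (Rest A a)) ⋁A′≡⋁A (⋁-mono A′⊆Rest)))
    where
    A′⊆Rest : A′ ⊆ Rest A a
    A′⊆Rest x∈A′ = ∈-Rest⁺ (A′⊆A x∈A′) λ { refl → a∉A′ x∈A′ }

  ⊆-irredundant⇒≡ : ∀ {A B} → Irredundant L B → A ⊆ B → ⋁ A ≡ ⋁ B → A ≡ B
  ⊆-irredundant⇒≡ {A} {B} B-irr A⊆B ⋁A≡⋁B = ⊆-antisym A⊆B B⊆A
    where
    B⊆A : B ⊆ A
    B⊆A {x} x∈B = decidable-stable (x ∈? A) λ x∉A → proj₂ (B-irr A (A⊆B , x , x∈B , x∉A)) ⋁A≡⋁B

  Tight-refinement⇒⊆ : ∀ {A B} → Tight A → JoinRefines L A B → JoinRefines L B A → A ⊆ B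
  Tight-refinement⇒⊆ {A} {B} A-tight A≼B B≼A {a} a∈A with A≼B a a∈A
  ... | b , b∈B , a≤b with B≼A b b∈B
  ...   | a′ , a′∈A , b≤a′ with a′ ≟ a
  ...     | yes refl = subst (_∈ B) (≤-antisym b≤a′ a≤b) b∈B
  ...     | no a′≢a  = contradiction (≤-trans (≤-trans a≤b b≤a′) (⋁-upper (∈-Rest⁺ a′∈A a′≢a)))
                                     (A-tight a a∈A)

  msd-≰-∨ : MeetSemidistributive L → ∀ {x s p q} → (∀ {e} → e < x → e ≤ s) →
            ¬ x ≤ s ∨ p → ¬ x ≤ s ∨ q → ¬ x ≤ (s ∨ p) ∨ (s ∨ q)
  msd-≰-∨ msd {x} {s} {p} {q} below≤s x≰s∨p x≰s∨q x≤ =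
    x≰s∨p (∧≡⇒≤ (begin
      x ∧ (s ∨ p)               ≡⟨ msd x (s ∨ p) (s ∨ q) (trans (meet≡ x≰s∨p) (sym (meet≡ x≰s∨q))) ⟨
      x ∧ ((s ∨ p) ∨ (s ∨ q))   ≡⟨ ≤⇒∧≡ x≤ ⟩
      x                         ∎))
    where
    open ≡-Reasoning

    meet≡ : ∀ {t} → ¬ x ≤ s ∨ t → x ∧ (s ∨ t) ≡ x ∧ s
    meet≡ {t} x≰s∨t = ≤-antisym
      (∧-greatest (x∧y≤x x _) (below≤s (x∧y≤x x _ , x≰s∨t ∘ ∧≡⇒≤)))
      (∧-greatest (x∧y≤x x s) (≤-trans (x∧y≤y x s) (x≤x∨y s t)))

  ≰⋁Rest-of-deletions : MeetSemidistributive L → ∀ {A x p q} → x ∈ A → p ∈ A → q ∈ A →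
                        p ≢ x → q ≢ x → p ≢ q → Tight (A - p) → Tight (A - q) → ¬ x ≤ ⋁ (Rest A x)
  ≰⋁Rest-of-deletions msd {A} {x} {p} {q} x∈A p∈A q∈A p≢x q≢x p≢q A-p-tight A-q-tight x≤⋁ =
    msd-≰-∨ msd (⋁-upper ∘ <⇒∈-Rest (A - p - q))
      (x≰s∨ A-q-tight (subst (_⊆ A - q) (p─x─y≡p─y─x A q p) x∈p-y⇒x∈p) q≢x p∈A p≢q p≢x)
      (x≰s∨ A-p-tight x∈p-y⇒x∈p p≢x q∈A (p≢q ∘ sym) q≢x)
      (≤-trans x≤⋁ (⋁Rest≤ other≤ (λ e<x → ≤-trans (⋁-upper (<⇒∈-Rest (A - p - q) e<x)) s≤)))
    where
    s : Elt L
    s = ⋁ (Rest (A - p - q) x)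

    s≤ : s ≤ (s ∨ p) ∨ (s ∨ q)
    s≤ = ≤-trans (x≤x∨y s p) (x≤x∨y _ _)

    x≰s∨ : ∀ {r r′} → Tight (A - r) → A - p - q ⊆ A - r → r ≢ x → r′ ∈ A → r′ ≢ r → r′ ≢ x →
         ¬ x ≤ s ∨ r′
    x≰s∨ A-r-tight ⊆A-r r≢x r′∈A r′≢r r′≢x x≤s∨r′ = A-r-tight x (x∈p∧x≢y⇒x∈p-y x∈A (r≢x ∘ sym))
      (≤-trans x≤s∨r′ (∨-least (⋁-mono (Rest-mono x ⊆A-r))
                               (⋁-upper (∈-Rest⁺ (x∈p∧x≢y⇒x∈p-y r′∈A r′≢r) r′≢x))))

    other≤ : ∀ {e} → e ∈ A - x → e ≤ (s ∨ p) ∨ (s ∨ q)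
    other≤ {e} e∈ with e ≟ p | e ≟ q
    ... | yes refl | _        = ≤-trans (y≤x∨y s p) (x≤x∨y _ _)
    ... | no _     | yes refl = ≤-trans (y≤x∨y s q) (y≤x∨y _ _)
    ... | no e≢p   | no e≢q   = ≤-trans (⋁-upper (∈-Rest⁺ e∈A-p-q (x∈p-y⇒x≢y e∈))) s≤
      where
      e∈A-p-q : e ∈ A - p - q
      e∈A-p-q = x∈p∧x≢y⇒x∈p-y (x∈p∧x≢y⇒x∈p-y (x∈p-y⇒x∈p e∈) e≢p) e≢q

  -- Canonical joinands

  module _ (jsd : JoinSemidistributive L) where

    MinimalJoinand : Elt L → Elt L → Elt L → Set
    MinimalJoinand y w = Minimal (λ γ → y ∨ γ ≡ w)

    -- The only use of join-semidistributivity: y ∨ (γ ∧ t) = y ∨ γ = w, so minimality of γ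
    -- forces γ ∧ t = γ.
    MinimalJoinand-≤ : ∀ {y w γ t} → MinimalJoinand y w γ → y ∨ t ≡ w → γ ≤ t
    MinimalJoinand-≤ {y} {w} {γ} {t} (y∨γ≡w , γ-min) y∨t≡w with (γ ∧ t) ≟ γ
    ... | yes γ∧t≡γ = ∧≡⇒≤ γ∧t≡γ
    ... | no γ∧t≢γ  = contradiction (trans (jsd y γ t (trans y∨γ≡w (sym y∨t≡w))) y∨γ≡w)
                                    (γ-min (x∧y≤x γ t , γ∧t≢γ))

    MinimalJoinand⇒≤ : ∀ {y w γ} → MinimalJoinand y w γ → γ ≤ w
    MinimalJoinand⇒≤ {y} {γ = γ} (y∨γ≡w , _) = subst (γ ≤_) y∨γ≡w (y≤x∨y y γ)

    MinimalJoinand⇒≰ : ∀ {y w γ} → y ⋖ w → MinimalJoinand y w γ → ¬ γ ≤ y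
    MinimalJoinand⇒≰ y⋖w (y∨γ≡w , _) γ≤y = ⋖⇒≱ y⋖w (subst (_≤ _) y∨γ≡w (∨-least ≤-refl γ≤y))

    ∃-MinimalJoinand : ∀ {y w} → y ≤ w → ∃ (MinimalJoinand y w)
    ∃-MinimalJoinand {y} {w} = minimal (λ γ → (y ∨ γ) ≟ w)

    IsJoinand : Elt L → Elt L → Set
    IsJoinand w γ = ∃[ y ] y ⋖ w × MinimalJoinand y w γ

    opaque
      Joinands : Elt L → Subset (suc m)
      Joinands w = toSubset λ γ → any? λ y → (y ⋖? w) ×-dec Minimal? (λ γ → (y ∨ γ) ≟ w) γ

      ∈-Joinands⁺ : ∀ {w γ} → IsJoinand w γ → γ ∈ Joinands w
      ∈-Joinands⁺ = ∈-toSubset⁺ _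

      ∈-Joinands⁻ : ∀ {w γ} → γ ∈ Joinands w → IsJoinand w γ
      ∈-Joinands⁻ = ∈-toSubset⁻ _

    ∈-Joinands⇒≤ : ∀ {w γ} → γ ∈ Joinands w → γ ≤ w
    ∈-Joinands⇒≤ γ∈ = MinimalJoinand⇒≤ (proj₂ (proj₂ (∈-Joinands⁻ γ∈)))

    ⋁Rest-Joinands≤ : ∀ {w y γ} → y ⋖ w → MinimalJoinand y w γ → ⋁ (Rest (Joinands w) γ) ≤ y
    ⋁Rest-Joinands≤ {w} {y} {γ} y⋖w γ-min = ⋁-least λ x∈ → bound (∈-Rest⁻ x∈)
      where
      other : ∀ {x} → IsJoinand w x → x ≢ γ → x ≤ y
      other (y′ , y′⋖w , x-min) x≢γ with y ≟ y′
      ... | yes refl = contradiction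
        (≤-antisym (MinimalJoinand-≤ x-min (proj₁ γ-min)) (MinimalJoinand-≤ γ-min (proj₁ x-min))) x≢γ
      ... | no y≢y′  = MinimalJoinand-≤ x-min
        (⋖-∨ y′⋖w (proj₁ (proj₁ y⋖w)) (⋖-incomparable y⋖w y′⋖w y≢y′))

      bound : ∀ {x} → (x ∈ Joinands w × x ≢ γ) ⊎ x < γ → x ≤ y
      bound (inj₁ (x∈ , x≢γ)) = other (∈-Joinands⁻ x∈) x≢γ
      bound {x} (inj₂ x<γ) = decidable-stable (x ≤? y) λ x≰y →
        proj₂ γ-min x<γ (⋖-∨ y⋖w (<-≤-trans x<γ (MinimalJoinand⇒≤ γ-min)) x≰y)

    Joinands-tight : ∀ w → Tight (Joinands w)
    Joinands-tight w γ γ∈ γ≤⋁ with ∈-Joinands⁻ γ∈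
    ... | y , y⋖w , γ-min =
      MinimalJoinand⇒≰ y⋖w γ-min (≤-trans γ≤⋁ (⋁Rest-Joinands≤ y⋖w γ-min))

    ⋁-Joinands : ∀ w → ⋁ (Joinands w) ≡ w
    ⋁-Joinands w = decidable-stable (⋁ (Joinands w) ≟ w) λ ⋁≢w →
      let y , ⋁≤y , y⋖w = ∃-⋖ (⋁-least ∈-Joinands⇒≤ , ⋁≢w)
          γ , γ-min     = ∃-MinimalJoinand (proj₁ (proj₁ y⋖w))
      in MinimalJoinand⇒≰ y⋖w γ-min (≤-trans (⋁-upper (∈-Joinands⁺ (y , y⋖w , γ-min))) ⋁≤y)

    Joinands-refines : ∀ {w B} → ⋁ B ≡ w → JoinRefines L (Joinands w) B
    Joinands-refines {w} {B} ⋁B≡w γ γ∈ with ∈-Joinands⁻ γ∈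
    ... | y , y⋖w , γ-min with ⋁≰⇒∃≰ {B} (λ ⋁B≤y → ⋖⇒≱ y⋖w (subst (_≤ y) ⋁B≡w ⋁B≤y))
    ...   | b , b∈B , b≰y =
      b , b∈B , MinimalJoinand-≤ γ-min (⋖-∨ y⋖w (subst (b ≤_) ⋁B≡w (⋁-upper b∈B)) b≰y)

    Tight⇒⊆Joinands : ∀ {A} → Tight A → A ⊆ Joinands (⋁ A)
    Tight⇒⊆Joinands {A} A-tight {a} a∈A
      with ∃-⋖ (⋁Rest≤⋁ a∈A , λ ⋁Rest≡⋁A → A-tight a a∈A (subst (a ≤_) (sym ⋁Rest≡⋁A) (⋁-upper a∈A)))
    ... | y , ⋁Rest≤y , y⋖⋁A = ∈-Joinands⁺ (y , y⋖⋁A , ⋖-∨ y⋖⋁A (⋁-upper a∈A) a≰y , a-minimal)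
      where
      rest≤y : ∀ {x} → x ∈ Rest A a → x ≤ y
      rest≤y x∈ = ≤-trans (⋁-upper x∈) ⋁Rest≤y

      a≰y : ¬ a ≤ y
      a≰y a≤y = ⋖⇒≱ y⋖⋁A (⋁-least below-y)
        where
        below-y : ∀ {x} → x ∈ A → x ≤ y
        below-y {x} x∈A with x ≟ a
        ... | yes refl = a≤y
        ... | no x≢a   = rest≤y (∈-Rest⁺ x∈A x≢a)

      a-minimal : ∀ {e} → e < a → y ∨ e ≢ ⋁ A
      a-minimal e<a y∨e≡⋁A =
        ⋖⇒≱ y⋖⋁A (subst (_≤ y) (trans (sym (≤⇒∨≡ (rest≤y (<⇒∈-Rest A e<a)))) y∨e≡⋁A) ≤-refl)

    Tight⇒≡Joinands : ∀ {A} → Tight A → A ≡ Joinands (⋁ A)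
    Tight⇒≡Joinands A-tight = ⊆-irredundant⇒≡ (Tight⇒Irredundant (Joinands-tight _))
      (Tight⇒⊆Joinands A-tight) (sym (⋁-Joinands _))

    Joinands-canonical : ∀ w → CanonicalJoinRep L w (Joinands w)
    Joinands-canonical w = minimality , uniqueness
      where
      rep : IrrJoinRep L w (Joinands w)
      rep = Tight⇒Irredundant (Joinands-tight w) , ⋁-Joinands w

      minimality : MinimalIrrJoinRep L w (Joinands w)
      minimality = rep , λ B (B-irr , ⋁B≡w) B≼J → sym (⊆-irredundant⇒≡ B-irr
        (Tight-refinement⇒⊆ (Joinands-tight w) (Joinands-refines ⋁B≡w) B≼J)
        (trans (⋁-Joinands w) (sym ⋁B≡w)))

      uniqueness : ∀ C → MinimalIrrJoinRep L w C → C ≡ Joinands w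
      uniqueness C ((_ , ⋁C≡w) , C-min) = sym (C-min (Joinands w) rep (Joinands-refines ⋁C≡w))

    Tight⇒Face : ∀ A → Tight A → Face L A
    Tight⇒Face A A-tight =
      subst (CanonicalJoinRep L (⋁ A)) (sym (Tight⇒≡Joinands A-tight)) (Joinands-canonical (⋁ A))

    Face⇒Tight : ∀ A → Face L A → Tight A
    Face⇒Tight A (_ , unique) =
      subst Tight (unique _ (proj₁ (Joinands-canonical (⋁ A)))) (Joinands-tight (⋁ A))

    Joinands-∨ : ∀ {y z γ} → γ ∈ Joinands (y ∨ z) → γ ≤ y ⊎ γ ≤ z
    Joinands-∨ {y} {z} γ∈ with ∈-Joinands⁻ γ∈
    ... | c , c⋖ , γ-min with y ≤? c | z ≤? c
    ... | yes y≤c | yes z≤c = contradiction (∨-least y≤c z≤c) (⋖⇒≱ c⋖)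
    ... | no y≰c  | _       = inj₁ (MinimalJoinand-≤ γ-min (⋖-∨ c⋖ (x≤x∨y y z) y≰c))
    ... | yes _   | no z≰c  = inj₂ (MinimalJoinand-≤ γ-min (⋖-∨ c⋖ (y≤x∨y y z) z≰c))

    -- Flagness and meet-semidistributivity

    meetSemidistributive⇒flag : MeetSemidistributive L → CanonicalJoinComplexIsFlag L
    meetSemidistributive⇒flag msd A (vertices , nonface , faces) with sizeView A
    ... | subsingleton A-sub = contradiction (Tight⇒Face A tight) nonface
      where
      tight : Tight A
      tight a a∈A = Tight-antitone (λ x∈A → subst (_∈ ⁅ a ⁆) (A-sub a∈A x∈A) (x∈⁅x⁆ a))
                                   (Face⇒Tight ⁅ a ⁆ (vertices a a∈A)) a a∈A
    ... | two ∣A∣≡2 = ∣A∣≡2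
    ... | atLeastThree three = contradiction (Tight⇒Face A tight) nonface
      where
      tight : Tight A
      tight x x∈A with two-others three x
      ... | p , q , p∈A , q∈A , p≢x , q≢x , p≢q =
        ≰⋁Rest-of-deletions msd x∈A p∈A q∈A p≢x q≢x p≢q (deletion-tight p∈A) (deletion-tight q∈A)
        where
        deletion-tight : ∀ {r} → r ∈ A → Tight (A - r)
        deletion-tight {r} r∈A = Face⇒Tight (A - r) (faces _ (x∈p⇒p-x⊂p r∈A))

    module NonFlag {j y z} (j≰y : ¬ j ≤ y) (j≰z : ¬ j ≤ z) (j≤y∨z : j ≤ y ∨ z)
                   (below-j : ∀ {e} → e < j → e ≤ y × e ≤ z) where

      G : Subset (suc m)
      G = Joinands (y ∨ z)

      N : Subset (suc m)
      N = ⁅ j ⁆ ∪ (G ─ Below j)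

      j∈N : j ∈ N
      j∈N = x∈p∪q⁺ (inj₁ (x∈⁅x⁆ j))

      ∈-N⁺ : ∀ {γ} → γ ∈ G → ¬ γ < j → γ ∈ N
      ∈-N⁺ γ∈G γ≮j = x∈p∪q⁺ (inj₂ (x∈p∧x∉q⇒x∈p─q γ∈G (γ≮j ∘ ∈-toSubset⁻ (_<? j))))

      ∈-N⁻ : ∀ {e} → e ∈ N → e ≡ j ⊎ (e ∈ G × ¬ e < j)
      ∈-N⁻ e∈N with x∈p∪q⁻ ⁅ j ⁆ (G ─ Below j) e∈N
      ... | inj₁ e∈⁅j⁆ = inj₁ (x∈⁅y⁆⇒x≡y j e∈⁅j⁆)
      ... | inj₂ e∈G─↓j = inj₂ (p─q⊆p G (Below j) e∈G─↓j ,
                                x∈p─q⇒x∉q G (Below j) e∈G─↓j ∘ ∈-toSubset⁺ (_<? j))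

      G-≢j : ∀ {γ} → γ ∈ G → γ ≢ j
      G-≢j γ∈G refl = [ j≰y , j≰z ]′ (Joinands-∨ γ∈G)

      N-not-tight : ¬ Tight N
      N-not-tight N-tight = N-tight j j∈N
        (≤-trans j≤y∨z (subst (_≤ ⋁ (Rest N j)) (⋁-Joinands (y ∨ z)) (⋁-least G⊆Rest)))
        where
        G⊆Rest : ∀ {γ} → γ ∈ G → γ ≤ ⋁ (Rest N j)
        G⊆Rest {γ} γ∈G with γ <? j
        ... | yes γ<j = ⋁-upper (<⇒∈-Rest N γ<j)
        ... | no γ≮j  = ⋁-upper (∈-Rest⁺ (∈-N⁺ γ∈G γ≮j) (G-≢j γ∈G))

      joinand-tight : ∀ {M a} → M ⊆ N → a ∈ G → ¬ a < j → ¬ a ≤ ⋁ (Rest M a)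
      joinand-tight {M} {a} M⊆N a∈G a≮j a≤⋁ with ∈-Joinands⁻ a∈G
      ... | c , c⋖ , a-min = a≮j (MinimalJoinand-≤ a-min (⋖-∨ c⋖ j≤y∨z j≰c) , G-≢j a∈G)
        where
        ⋁Rest≤j∨c : ⋁ (Rest M a) ≤ j ∨ c
        ⋁Rest≤j∨c = ⋁Rest≤ other≤ (λ e<a → ≤-trans (⋁-upper (<⇒∈-Rest G e<a)) joinand-rest≤)
          where
          joinand-rest≤ : ⋁ (Rest G a) ≤ j ∨ c
          joinand-rest≤ = ≤-trans (⋁Rest-Joinands≤ c⋖ a-min) (y≤x∨y j c)

          other≤ : ∀ {e} → e ∈ M - a → e ≤ j ∨ c
          other≤ e∈ with ∈-N⁻ (M⊆N (x∈p-y⇒x∈p e∈))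
          ... | inj₁ refl = x≤x∨y j c
          ... | inj₂ (e∈G , _) = ≤-trans (⋁-upper (∈-Rest⁺ e∈G (x∈p-y⇒x≢y e∈))) joinand-rest≤

        j≰c : ¬ j ≤ c
        j≰c j≤c = MinimalJoinand⇒≰ c⋖ a-min (≤-trans a≤⋁ (≤-trans ⋁Rest≤j∨c (∨-least j≤c ≤-refl)))

      j-tight : ∀ {M} → M ⊆ N → Subsingleton (M - j) → ¬ j ≤ ⋁ (Rest M j)
      j-tight {M} M⊆N M-j-sub with nonempty? (M - j)
      ... | no ∄e = ≰⋁Rest j≰y (λ e∈ → contradiction (_ , e∈) ∄e) (proj₁ ∘ below-j)
      ... | yes (g , g∈) with ∈-N⁻ (M⊆N (x∈p-y⇒x∈p g∈))
      ...   | inj₁ g≡j = contradiction g≡j (x∈p-y⇒x≢y g∈)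
      ...   | inj₂ (g∈G , _) with Joinands-∨ g∈G
      ...     | inj₁ g≤y = ≰⋁Rest j≰y (λ e∈ → subst (_≤ y) (M-j-sub g∈ e∈) g≤y) (proj₁ ∘ below-j)
      ...     | inj₂ g≤z = ≰⋁Rest j≰z (λ e∈ → subst (_≤ z) (M-j-sub g∈ e∈) g≤z) (proj₂ ∘ below-j)

      small-tight : ∀ {M} → M ⊆ N → ¬ ThreeDistinct M → Tight M
      small-tight {M} M⊆N ¬three a a∈M with ∈-N⁻ (M⊆N a∈M)
      ... | inj₁ refl          = j-tight M⊆N (¬ThreeDistinct⇒Subsingleton-minus ¬three a∈M)
      ... | inj₂ (a∈G , a≮j) = joinand-tight M⊆N a∈G a≮j

      minimal-non-tight⇒¬flag : ∀ {M} → M ⊆ N → ¬ Tight M → (∀ {B} → B ⊂ M → B ⊆ N → Tight B) →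
                                ¬ CanonicalJoinComplexIsFlag L
      minimal-non-tight⇒¬flag {M} M⊆N M-not-tight proper-tight flag = M-not-tight (small-tight M⊆N ¬three)
        where
        vertex : ∀ v → v ∈ M → Vertex L v
        vertex v v∈M = Tight⇒Face ⁅ v ⁆ (small-tight ⁅v⁆⊆N (Subsingleton⇒¬ThreeDistinct ⁅v⁆-subsingleton))
          where
          ⁅v⁆⊆N : ⁅ v ⁆ ⊆ N
          ⁅v⁆⊆N x∈ = subst (_∈ N) (sym (x∈⁅y⁆⇒x≡y v x∈)) (M⊆N v∈M)

          ⁅v⁆-subsingleton : Subsingleton ⁅ v ⁆
          ⁅v⁆-subsingleton x∈ y∈ = trans (x∈⁅y⁆⇒x≡y v x∈) (sym (x∈⁅y⁆⇒x≡y v y∈))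

        proper-face : ∀ B → B ⊂ M → Face L B
        proper-face B B⊂M = Tight⇒Face B (proper-tight B⊂M (⊆-trans (p⊂q⇒p⊆q B⊂M) M⊆N))

        ¬three : ¬ ThreeDistinct M
        ¬three three = <-irrefl refl
          (subst (3 ℕ.≤_) (flag M (vertex , M-not-tight ∘ Face⇒Tight M , proper-face)) (3≤∣p∣ three))

      not-flag : ¬ CanonicalJoinComplexIsFlag L
      not-flag =
        let M , (M⊆N , M-not-tight) , M-minimal =
              ⊂-minimal (λ B → (B ⊆? N) ×-dec ¬? (Tight? B)) (⊆-refl , N-not-tight)
        in minimal-non-tight⇒¬flag M⊆N M-not-tight λ {B} B⊂M B⊆N →
             decidable-stable (Tight? B) (M-minimal B⊂M ∘ (B⊆N ,_))

    minimal-failure⇒¬flag : ∀ {x y z j} → x ∧ y ≡ x ∧ z →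
                            Minimal (λ t → t ≤ x ∧ (y ∨ z) × ¬ t ≤ x ∧ y) j →
                            ¬ CanonicalJoinComplexIsFlag L
    minimal-failure⇒¬flag {x} {y} {z} {j} x∧y≡x∧z ((j≤x∧[y∨z] , j≰x∧y) , j-minimal) =
      NonFlag.not-flag j≰y j≰z (≤-trans j≤x∧[y∨z] (x∧y≤y x _)) below-j
      where
      j≤x : j ≤ x
      j≤x = ≤-trans j≤x∧[y∨z] (x∧y≤x x _)

      j≰y : ¬ j ≤ y
      j≰y j≤y = j≰x∧y (∧-greatest j≤x j≤y)

      j≰z : ¬ j ≤ z
      j≰z j≤z = j≰x∧y (subst (j ≤_) (sym x∧y≡x∧z) (∧-greatest j≤x j≤z))

      below-j : ∀ {e} → e < j → e ≤ y × e ≤ z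
      below-j {e} e<j = ≤-trans e≤x∧y (x∧y≤y x y) , ≤-trans (subst (e ≤_) x∧y≡x∧z e≤x∧y) (x∧y≤y x z)
        where
        e≤x∧y : e ≤ x ∧ y
        e≤x∧y = decidable-stable (e ≤? x ∧ y) λ e≰x∧y →
          j-minimal e<j (≤-trans (proj₁ e<j) j≤x∧[y∨z] , e≰x∧y)

    flag⇒meetSemidistributive : CanonicalJoinComplexIsFlag L → MeetSemidistributive L
    flag⇒meetSemidistributive flag x y z x∧y≡x∧z = ≤-antisym
      (decidable-stable (x ∧ (y ∨ z) ≤? x ∧ y) λ x∧[y∨z]≰x∧y →
        minimal-failure⇒¬flag x∧y≡x∧z (proj₂ (minimal failure? (≤-refl , x∧[y∨z]≰x∧y))) flag)
      (∧-greatest (x∧y≤x x y) (≤-trans (x∧y≤y x y) (x≤x∨y y z)))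
      where
      failure? : Decidable (λ t → t ≤ x ∧ (y ∨ z) × ¬ t ≤ x ∧ y)
      failure? t = (t ≤? x ∧ (y ∨ z)) ×-dec ¬? (t ≤? x ∧ y)

theorem1p1 : (L : FiniteLattice) → JoinSemidistributive L →
    (CanonicalJoinComplexIsFlag L ⇔ Semidistributive L)
theorem1p1 L jsd = mk⇔
  (λ flag → jsd , flag⇒meetSemidistributive L jsd flag)
  (λ (_ , msd) → meetSemidistributive⇒flag L jsd msd)
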